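{- Let $\mathcal{C}$ be a set of subsets of $E$ each containing at most one skew pair, such that (Orth) $|C_1\cap C_2^*|\ne1$ for all $C_1,C_2\in\mathcal{C}$, and (Max) for every transversal $T$ and every $e\in T^*$ there is $C\in\mathcal{C}$ with $C\subseteq T\cup\{e\}$. Then $\mathcal{C}$ satisfies: (Add) for distinct $C_1,C_2\in\mathcal{C}$ and $e\in C_1\cap C_2$, if $(C_1\cup C_2)\setminus\{e\}$ contains at most one skew pair, then there is $C_3\in\mathcal{C}$ with $C_3\subseteq(C_1\cup C_2)\setminus\{e\}$.
   Context: Let $E=[n]\cup[n]^*$ with involution $i\leftrightarrow i^*$, extended to sets by $X^*=\{x^*:x\in X\}$ (with $(i^*)^*=i$). A skew pair is a set $\{i,i^*\}$; a transversal is an $n$-subset of $E$ containing no skew pair. -}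

module Defs where

open import Data.Nat using (ℕ; zero; suc; _+_; _≤_)
open import Data.Fin using (Fin)
open import Data.Bool using (Bool; true; false; not; _∧_; _∨_; if_then_else_)
open import Data.Product using (_×_; _,_)
open import Data.Vec.Functional using (Vector; foldr)
open import Relation.Binary.PropositionalEquality using (_≡_)
open import Relation.Nullary using (¬_)

-- Ground set E = [n] ∪ [n]^* : element (i , false) is i, (i , true) is i^*.
E : ℕ → Set
E n = Fin n × Bool

star : ∀ {n} → E n → E n
star (i , b) = (i , not b)

SubE : ℕ → Set
SubE n = E n → Bool

_ᶜstar : ∀ {n} → SubE n → SubE n
(X ᶜstar) e = X (star e)

_∩_ : ∀ {n} → SubE n → SubE n → SubE n
(X ∩ Y) e = X e ∧ Y e

_∪_ : ∀ {n} → SubE n → SubE n → SubE n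
(X ∪ Y) e = X e ∨ Y e

open import Data.Fin using (_≟_)
open import Data.Bool using () renaming (_≟_ to _≟B_)
open import Relation.Nullary using (yes; no)

eqE : ∀ {n} → E n → E n → Bool
eqE (i , b) (j , c) with i ≟ j | b ≟B c
... | yes _ | yes _ = true
... | _     | _     = false

single : ∀ {n} → E n → SubE n
single e x = eqE e x

remove : ∀ {n} → SubE n → E n → SubE n
remove X e x = X x ∧ not (eqE e x)

b2n : Bool → ℕ
b2n true  = 1
b2n false = 0

sumFin : ∀ {n} → (Fin n → ℕ) → ℕ
sumFin f = foldr _+_ 0 f

card : ∀ {n} → SubE n → ℕ
card X = sumFin (λ i → b2n (X (i , false)) + b2n (X (i , true)))

skewPairs : ∀ {n} → SubE n → ℕ
skewPairs X = sumFin (λ i → b2n (X (i , false) ∧ X (i , true)))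

_∈_ : ∀ {n} → E n → SubE n → Set
e ∈ X = X e ≡ true

_⊆_ : ∀ {n} → SubE n → SubE n → Set
X ⊆ Y = ∀ e → e ∈ X → e ∈ Y

IsTransversal : ∀ {n} → SubE n → Set
IsTransversal {n} T = (card T ≡ n) × (skewPairs T ≡ 0)

_≐_ : ∀ {n} → SubE n → SubE n → Set
X ≐ Y = ∀ e → X e ≡ Y e

-- a set 𝒞 of subsets of E, given as a predicate on subsets (closed under ≐)
Family : ℕ → Set₁
Family n = SubE n → Set

{-# OPTIONS --safe #-}

-- The heart of the proof is a Minty-type alternative.  Let f ∈ W ⊆ E be such that every skew pair
-- contained in W lies over the coordinate of f.  Then either some circuit lies inside W, or some
-- circuit D contains f* and meets W* only in f*.  This is proved by induction on the number of
-- coordinates that W misses.  If W meets every coordinate, then (W ∖ {f}) ∪ {f*} contains a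
-- transversal T with f ∈ T*, and (Max) for T and f yields the alternative.  If W misses the coordinate
-- j, the induction hypothesis for W ∪ {(j , false)} and W ∪ {(j , true)} yields the alternative for W
-- unless it produces circuits C₀ ∋ (j , false) and C₁ ∋ (j , true) inside W ∪ {(j , false)} and
-- W ∪ {(j , true)}.  Then C₀ ∩ C₁* = {(j , false)}, against (Orth), unless f* ∈ W; in that case the
-- alternative for (W ∖ {f}) ∪ {(j , false), (j , true)} at (j , false) transfers back to W and f,
-- again by (Orth) against C₀ and C₁.
--
-- For (Add), apply the alternative to W = (C₁ ∪ C₂) ∖ {e} and some f ∈ C₁ ∖ C₂: a circuit D of the
-- second kind would satisfy C₁ ∩ D* = {f} if e* ∉ D, and C₂ ∩ D* = {e} if e* ∈ D.  The skew pair
-- {b, b*} that W may contain has to lie over the coordinate of f, so f is taken from {b, b*} whenever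
-- possible.  Otherwise b and b* lie in C₁ ∩ C₂; then (C₁ ∪ C₂) ∖ {b} is skew-free, so eliminating b
-- instead of e gives a circuit C₃ avoiding b, and eliminating e between C₁ and C₃ (with f = b)
-- finishes the proof.
module Submission where

open import Defs
open import Data.Bool using (Bool; true; false; not; _∧_)
open import Data.Bool.Properties using (not-involutive; ¬-not; ∨-zeroʳ) renaming (_≟_ to _≟ᵇ_)
open import Data.Empty using (⊥; ⊥-elim)
open import Data.Fin using (Fin; zero; suc; punchIn; punchOut) renaming (_≟_ to _≟ᶠ_)
open import Data.Fin.Properties using (punchInᵢ≢i; punchIn-punchOut; ¬∀⟶∃¬; any?)
open import Data.List using (List; []; _∷_; allFin)
open import Data.List.Membership.Propositional using () renaming (_∈_ to _∈ˡ_)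
open import Data.List.Membership.Propositional.Properties using (∈-allFin)
open import Data.List.Relation.Unary.Any using (here; there)
open import Data.Nat using (ℕ; zero; suc; _+_; _≤_)
open import Data.Nat.Properties
  using (+-0-commutativeMonoid; +-identityʳ; +-monoʳ-≤; m≤m+n; <-irrefl; ≤-trans; module ≤-Reasoning)
open import Data.Product using (Σ; ∃-syntax; _×_; _,_; proj₁; proj₂)
open import Data.Product.Properties using (≡-dec)
open import Data.Sum using (_⊎_; inj₁; inj₂)
import Data.Sum as Sum
open import Data.Vec.Functional using (Vector; removeAt)
open import Function using (_∘_; id)
open import Relation.Binary.Definitions using (DecidableEquality)
open import Relation.Binary.PropositionalEquality
  using (_≡_; _≢_; refl; sym; trans; cong; cong₂; subst; module ≡-Reasoning)
open import Relation.Nullary using (¬_; Dec; yes; no; does; _×-dec_)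
open import Relation.Nullary.Decidable using (dec-true)

open import Algebra.Properties.CommutativeMonoid.Sum +-0-commutativeMonoid
  using (sum-remove; sum-cong-≗; sum-replicate-zero)

private variable
  n : ℕ
  i j : Fin n
  a b e f x y : E n
  X Y Z C D C₁ C₂ : SubE n
  𝒞 : Family n

_∉_ : E n → SubE n → Set
x ∉ X = ¬ x ∈ X

_∈?_ : (x : E n) (X : SubE n) → Dec (x ∈ X)
x ∈? X = X x ≟ᵇ true

_≟ᴱ_ : DecidableEquality (E n)
_≟ᴱ_ = ≡-dec _≟ᶠ_ _≟ᵇ_

star-involutive : (x : E n) → star (star x) ≡ x
star-involutive (i , s) = cong (i ,_) (not-involutive s)

≡star⇒star≡ : x ≡ star y → star x ≡ y
≡star⇒star≡ {y = y} refl = star-involutive y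

star≡⇒≡star : star x ≡ y → x ≡ star y
star≡⇒≡star {x = x} refl = sym (star-involutive x)

star-injective : star x ≡ star y → x ≡ y
star-injective {y = y} x*≡y* = trans (star≡⇒≡star x*≡y*) (star-involutive y)

star≢ : (x : E n) → star x ≢ x
star≢ (i , false) ()
star≢ (i , true) ()

same-coordinate : (y : E n) → proj₁ x ≡ proj₁ y → x ≡ y ⊎ x ≡ star y
same-coordinate {x = i , s} (.i , t) refl with s ≟ᵇ t
... | yes refl = inj₁ refl
... | no s≢t = inj₂ (cong (i ,_) (¬-not s≢t))

∧-true⁻ : ∀ p {q} → p ∧ q ≡ true → p ≡ true × q ≡ true
∧-true⁻ true {true} _ = refl , refl
∧-true⁻ true {false} ()
∧-true⁻ false ()

∈-∪⁻ : (X Y : SubE n) → x ∈ (X ∪ Y) → x ∈ X ⊎ x ∈ Y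
∈-∪⁻ {x = x} X Y p with X x
... | true = inj₁ refl
... | false = inj₂ p

∈-∪ˡ : (X Y : SubE n) → x ∈ X → x ∈ (X ∪ Y)
∈-∪ˡ X Y x∈X rewrite x∈X = refl

∈-∪ʳ : (X Y : SubE n) → x ∈ Y → x ∈ (X ∪ Y)
∈-∪ʳ {x = x} X Y x∈Y rewrite x∈Y = ∨-zeroʳ (X x)

∈-∩⁺ : (X Y : SubE n) → x ∈ X → x ∈ Y → x ∈ (X ∩ Y)
∈-∩⁺ X Y x∈X x∈Y rewrite x∈X | x∈Y = refl

∈-∩⁻ : (X Y : SubE n) → x ∈ (X ∩ Y) → x ∈ X × x ∈ Y
∈-∩⁻ {x = x} X Y = ∧-true⁻ (X x)

∈-∪-agree : (X Y : SubE n) → x ∈ (X ∪ Y) → X x ≡ Y x → x ∈ X × x ∈ Y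
∈-∪-agree X Y p same with ∈-∪⁻ X Y p
... | inj₁ x∈X = x∈X , trans (sym same) x∈X
... | inj₂ x∈Y = trans same x∈Y , x∈Y

eqE-sound : (a x : E n) → eqE a x ≡ true → a ≡ x
eqE-sound (i , s) (j , t) p with i ≟ᶠ j | s ≟ᵇ t
eqE-sound (i , s) (.i , .s) p | yes refl | yes refl = refl
eqE-sound (i , s) (j , t) () | yes _ | no _
eqE-sound (i , s) (j , t) () | no _ | _

eqE-refl : (a : E n) → eqE a a ≡ true
eqE-refl (i , s) with i ≟ᶠ i | s ≟ᵇ s
... | yes _ | yes _ = refl
... | no i≢i | _ = ⊥-elim (i≢i refl)
... | yes _ | no s≢s = ⊥-elim (s≢s refl)

∈-single⁺ : (a : E n) → a ∈ single a
∈-single⁺ = eqE-refl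

∈-single⁻ : ∀ a → x ∈ single a → x ≡ a
∈-single⁻ {x = x} a p = sym (eqE-sound a x p)

∈-∪-single⁻ : (X : SubE n) (a : E n) → x ∈ (X ∪ single a) → x ∈ X ⊎ x ≡ a
∈-∪-single⁻ X a = Sum.map₂ (∈-single⁻ a) ∘ ∈-∪⁻ X (single a)

∈-remove⁺ : (X : SubE n) → x ∈ X → x ≢ a → x ∈ remove X a
∈-remove⁺ {a = a} X x∈X x≢a rewrite x∈X = cong not (¬-not (x≢a ∘ ∈-single⁻ a))

∈-remove⁻ : (X : SubE n) (a : E n) → x ∈ remove X a → x ∈ X × x ≢ a
∈-remove⁻ {x = x} X a p = proj₁ (∧-true⁻ (X x) p) , x≢a
  where
  x≢a : x ≢ a
  x≢a refl with eqE a a | eqE-refl a | proj₂ (∧-true⁻ (X x) p)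
  ... | .true | refl | ()

⊆-trans : X ⊆ Y → Y ⊆ Z → X ⊆ Z
⊆-trans X⊆Y Y⊆Z x = Y⊆Z x ∘ X⊆Y x

⊆-∪ˡ : (X Y : SubE n) → X ⊆ (X ∪ Y)
⊆-∪ˡ X Y _ = ∈-∪ˡ X Y

⊆-∪ʳ : (X Y : SubE n) → Y ⊆ (X ∪ Y)
⊆-∪ʳ X Y _ = ∈-∪ʳ X Y

remove-⊆ : (X : SubE n) (a : E n) → remove X a ⊆ X
remove-⊆ X a _ = proj₁ ∘ ∈-remove⁻ X a

⊆-remove : (X : SubE n) → a ∉ X → X ⊆ remove X a
⊆-remove X a∉X x x∈X = ∈-remove⁺ X x∈X λ { refl → a∉X x∈X }

remove-mono : X ⊆ Y → remove X a ⊆ remove Y a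
remove-mono {X = X} {Y = Y} {a = a} X⊆Y x p =
  let (x∈X , x≢a) = ∈-remove⁻ X a p in ∈-remove⁺ Y (X⊆Y x x∈X) x≢a

fibre : Fin n → SubE n
fibre j x = does (proj₁ x ≟ᶠ j)

∈-fibre⁺ : ∀ j s → (j , s) ∈ fibre {n} j
∈-fibre⁺ j s = dec-true (j ≟ᶠ j) refl

∈-fibre⁻ : ∀ j → x ∈ fibre j → proj₁ x ≡ j
∈-fibre⁻ {x = x} j p with proj₁ x ≟ᶠ j
∈-fibre⁻ j p | yes x∈j = x∈j
∈-fibre⁻ j () | no _

∈-remove-∪-fibre⁻ : (X : SubE n) (f : E n) (j : Fin n) →
                    x ∈ (remove X f ∪ fibre j) → (x ∈ X × x ≢ f) ⊎ proj₁ x ≡ j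
∈-remove-∪-fibre⁻ {x = x} X f j p =
  Sum.map (∈-remove⁻ {x = x} X f) (∈-fibre⁻ {x = x} j) (∈-∪⁻ {x = x} (remove X f) (fibre j) p)

graph : (Fin n → Bool) → SubE n
graph σ (j , s) = does (s ≟ᵇ σ j)

∈-graph⁺ : (σ : Fin n → Bool) (x : E n) → proj₂ x ≡ σ (proj₁ x) → x ∈ graph σ
∈-graph⁺ σ (j , s) s≡σj = dec-true (s ≟ᵇ σ j) s≡σj

∈-graph⁻ : (σ : Fin n → Bool) → x ∈ graph σ → proj₂ x ≡ σ (proj₁ x)
∈-graph⁻ {x = j , s} σ p with s ≟ᵇ σ j
∈-graph⁻ σ p | yes s≡σj = s≡σj
∈-graph⁻ σ () | no _

sum-ones : (t : Vector ℕ n) → (∀ i → t i ≡ 1) → sumFin t ≡ n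
sum-ones {zero} t ones = refl
sum-ones {suc n} t ones = cong₂ _+_ (ones zero) (sum-ones (t ∘ suc) (ones ∘ suc))

sum-zeros : (t : Vector ℕ n) → (∀ i → t i ≡ 0) → sumFin t ≡ 0
sum-zeros {n} t zeros = trans (sum-cong-≗ zeros) (sum-replicate-zero n)

sum-single : (t : Vector ℕ n) (i : Fin n) → (∀ j → j ≢ i → t j ≡ 0) → sumFin t ≡ t i
sum-single {suc n} t i zeros = begin
  sumFin t                     ≡⟨ sum-remove {i = i} t ⟩
  t i + sumFin (removeAt t i)  ≡⟨ cong (t i +_) (sum-zeros _ λ k → zeros _ (punchInᵢ≢i i k)) ⟩
  t i + 0                      ≡⟨ +-identityʳ (t i) ⟩
  t i                          ∎
  where open ≡-Reasoning

term≤sum : (t : Vector ℕ n) (i : Fin n) → t i ≤ sumFin t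
term≤sum {suc n} t i = subst (t i ≤_) (sym (sum-remove {i = i} t)) (m≤m+n (t i) _)

two-terms≤sum : (t : Vector ℕ n) → i ≢ j → t i + t j ≤ sumFin t
two-terms≤sum {suc n} {i} {j} t i≢j = begin
  t i + t j                          ≡⟨ cong (λ k → t i + t k) (punchIn-punchOut i≢j) ⟨
  t i + removeAt t i (punchOut i≢j)  ≤⟨ +-monoʳ-≤ (t i) (term≤sum (removeAt t i) _) ⟩
  t i + sumFin (removeAt t i)        ≡⟨ sum-remove {i = i} t ⟨
  sumFin t                           ∎
  where open ≤-Reasoning

card-graph : (σ : Fin n → Bool) → card (graph σ) ≡ n
card-graph σ = sum-ones _ one-per-coordinate
  where
  one-per-coordinate : ∀ j → b2n (graph σ (j , false)) + b2n (graph σ (j , true)) ≡ 1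
  one-per-coordinate j with σ j
  ... | false = refl
  ... | true = refl

skewPairs-graph : (σ : Fin n → Bool) → skewPairs (graph σ) ≡ 0
skewPairs-graph σ = sum-zeros _ no-pair
  where
  no-pair : ∀ j → b2n (graph σ (j , false) ∧ graph σ (j , true)) ≡ 0
  no-pair j with σ j
  ... | false = refl
  ... | true = refl

graph-isTransversal : (σ : Fin n → Bool) → IsTransversal (graph σ)
graph-isTransversal σ = card-graph σ , skewPairs-graph σ

card-singleton : (X : SubE n) (a : E n) → a ∈ X → (∀ x → x ∈ X → x ≡ a) → card X ≡ 1
card-singleton X (i , s) a∈X only =
  trans (sum-single _ i elsewhere) (at-i s a∈X (absent (star≢ (i , s))))
  where
  absent : ∀ {x} → x ≢ (i , s) → X x ≡ false
  absent x≢a = ¬-not (x≢a ∘ only _)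
  elsewhere : ∀ j → j ≢ i → b2n (X (j , false)) + b2n (X (j , true)) ≡ 0
  elsewhere j j≢i
    rewrite absent {j , false} (j≢i ∘ cong proj₁) | absent {j , true} (j≢i ∘ cong proj₁) = refl
  at-i : ∀ t → X (i , t) ≡ true → X (i , not t) ≡ false →
         b2n (X (i , false)) + b2n (X (i , true)) ≡ 1
  at-i false p q rewrite p | q = refl
  at-i true p q rewrite p | q = refl

SkewPairsAt : SubE n → Fin n → Set
SkewPairsAt X j = ∀ x → x ∈ X → star x ∈ X → proj₁ x ≡ j

SkewFree : SubE n → Set
SkewFree X = ∀ x → x ∈ X → star x ∉ X

SkewFree⇒SkewPairsAt : SkewFree X → SkewPairsAt X j
SkewFree⇒SkewPairsAt free x x∈X x*∈X = ⊥-elim (free x x∈X x*∈X)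

SkewPairsAt⇒≡⊎≡star : (X : SubE n) (f : E n) → SkewPairsAt X (proj₁ f) →
                      x ∈ X → star x ∈ X → x ≡ f ⊎ x ≡ star f
SkewPairsAt⇒≡⊎≡star {x = x} X f pairs x∈X x*∈X = same-coordinate f (pairs x x∈X x*∈X)

SkewPairsAt⇒≡star : (X : SubE n) (f : E n) → SkewPairsAt X (proj₁ f) →
                    x ∈ X → star x ∈ X → x ≢ f → x ≡ star f
SkewPairsAt⇒≡star X f pairs x∈X x*∈X x≢f =
  Sum.[ ⊥-elim ∘ x≢f , id ] (SkewPairsAt⇒≡⊎≡star X f pairs x∈X x*∈X)

pair-components : (X : SubE n) → x ∈ X → star x ∈ X →
                  (proj₁ x , false) ∈ X × (proj₁ x , true) ∈ X
pair-components {x = i , false} X p q = p , q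
pair-components {x = i , true} X p q = q , p

skewFree⊎skewPair : (X : SubE n) → SkewFree X ⊎ ∃[ x ] (x ∈ X × star x ∈ X)
skewFree⊎skewPair X with any? (λ j → ((j , false) ∈? X) ×-dec ((j , true) ∈? X))
... | yes (j , p , q) = inj₂ ((j , false) , p , q)
... | no none = inj₁ λ x x∈X x*∈X → none (proj₁ x , pair-components X x∈X x*∈X)

skewPairs≤1⇒SkewPairsAt : (X : SubE n) → skewPairs X ≤ 1 → a ∈ X → star a ∈ X →
                          SkewPairsAt X (proj₁ a)
skewPairs≤1⇒SkewPairsAt {a = a} X ≤1 a∈X a*∈X x x∈X x*∈X with proj₁ x ≟ᶠ proj₁ a
... | yes same = same
... | no differ = ⊥-elim (<-irrefl refl (≤-trans 2≤skewPairs ≤1))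
  where
  pair-term : ∀ {y} → y ∈ X → star y ∈ X → b2n (X (proj₁ y , false) ∧ X (proj₁ y , true)) ≡ 1
  pair-term {y} y∈X y*∈X with pair-components {x = y} X y∈X y*∈X
  ... | p , q rewrite p | q = refl
  2≤skewPairs : 2 ≤ skewPairs X
  2≤skewPairs = subst (_≤ skewPairs X) (cong₂ _+_ (pair-term x∈X x*∈X) (pair-term a∈X a*∈X))
                      (two-terms≤sum _ differ)

SkewPairsAt⇒SkewFree-remove : (X : SubE n) (b : E n) → SkewPairsAt X (proj₁ b) → SkewFree (remove X b)
SkewPairsAt⇒SkewFree-remove X b pairs x x∈ x*∈
  with ∈-remove⁻ {x = x} X b x∈ | ∈-remove⁻ {x = star x} X b x*∈
... | x∈X , x≢b | x*∈X , x*≢b =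
  x*≢b (≡star⇒star≡ (SkewPairsAt⇒≡star X b pairs x∈X x*∈X x≢b))

SkewPairsAt-∪ : (X Y : SubE n) → e ∈ X → e ∈ Y → SkewPairsAt X j → SkewPairsAt Y j →
                SkewPairsAt (remove (X ∪ Y) e) j → SkewPairsAt (X ∪ Y) j
SkewPairsAt-∪ {e = e} {j = j} X Y e∈X e∈Y pairsX pairsY pairs x x∈ x*∈ =
  by-cases (x ≟ᴱ e) (star x ≟ᴱ e)
  where
  over-e : star e ∈ (X ∪ Y) → proj₁ e ≡ j
  over-e = Sum.[ pairsX e e∈X , pairsY e e∈Y ] ∘ ∈-∪⁻ X Y
  by-cases : Dec (x ≡ e) → Dec (star x ≡ e) → proj₁ x ≡ j
  by-cases (yes x≡e) _ = trans (cong proj₁ x≡e) (over-e (subst (λ z → star z ∈ (X ∪ Y)) x≡e x*∈))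
  by-cases _ (yes x*≡e) =
    trans (cong proj₁ x*≡e) (over-e (subst (_∈ (X ∪ Y)) (star≡⇒≡star x*≡e) x∈))
  by-cases (no x≢e) (no x*≢e) =
    pairs x (∈-remove⁺ (X ∪ Y) x∈ x≢e) (∈-remove⁺ (X ∪ Y) x*∈ x*≢e)

Covered : SubE n → Fin n → Set
Covered X j = ∃[ x ] (x ∈ X × proj₁ x ≡ j)

covered? : (X : SubE n) (j : Fin n) → Dec (Covered X j)
covered? X j with (j , false) ∈? X | (j , true) ∈? X
... | yes p | _ = yes ((j , false) , p , refl)
... | _ | yes q = yes ((j , true) , q , refl)
... | no p | no q = no λ { ((_ , false) , r , refl) → p r ; ((_ , true) , r , refl) → q r }

∉-uncovered : ¬ Covered X j → proj₁ x ≡ j → x ∉ X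
∉-uncovered {x = x} uncovered x∈j x∈X = uncovered (x , x∈X , x∈j)

Covered-∪ˡ : (X Y : SubE n) → Covered X j → Covered (X ∪ Y) j
Covered-∪ˡ X Y (x , x∈X , x∈j) = x , ∈-∪ˡ X Y x∈X , x∈j

Covered-remove : (X : SubE n) (f : E n) → star f ∈ X → Covered X j → Covered (remove X f) j
Covered-remove X f f*∈X (x , x∈X , x∈j) with x ≟ᴱ f
... | no x≢f = x , ∈-remove⁺ X x∈X x≢f , x∈j
... | yes refl = star x , ∈-remove⁺ X f*∈X (star≢ x) , x∈j

CoveredOutside : SubE n → List (Fin n) → Set
CoveredOutside X L = ∀ j → Covered X j ⊎ j ∈ˡ L

CoveredOutside-∷ : ∀ {L} → Covered Y j → (∀ {i} → Covered X i → Covered Y i) →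
                   CoveredOutside X (j ∷ L) → CoveredOutside Y L
CoveredOutside-∷ c mono cov i with cov i
... | inj₁ ci = inj₁ (mono ci)
... | inj₂ (here refl) = inj₁ c
... | inj₂ (there i∈L) = inj₂ i∈L

SkewPairsAt-∪-single : (X : SubE n) (a : E n) → ¬ Covered X (proj₁ a) →
                       SkewPairsAt X j → SkewPairsAt (X ∪ single a) j
SkewPairsAt-∪-single X a uncovered pairs x x∈ x*∈
  with ∈-∪-single⁻ X a x∈ | ∈-∪-single⁻ X a x*∈
... | inj₁ x∈X | inj₁ x*∈X = pairs x x∈X x*∈X
... | inj₁ x∈X | inj₂ x*≡a = ⊥-elim (∉-uncovered uncovered (cong proj₁ x*≡a) x∈X)
... | inj₂ x≡a | inj₁ x*∈X = ⊥-elim (∉-uncovered uncovered (cong proj₁ x≡a) x*∈X)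
... | inj₂ x≡a | inj₂ x*≡a = ⊥-elim (star≢ x (trans x*≡a (sym x≡a)))

SkewPairsAt-remove-∪-fibre : (X : SubE n) (f : E n) (j : Fin n) →
                             SkewPairsAt X (proj₁ f) → SkewPairsAt (remove X f ∪ fibre j) j
SkewPairsAt-remove-∪-fibre X f j pairs x x∈ x*∈
  with ∈-remove-∪-fibre⁻ X f j x∈ | ∈-remove-∪-fibre⁻ X f j x*∈
... | inj₂ x∈j | _ = x∈j
... | _ | inj₂ x*∈j = x*∈j
... | inj₁ (x∈X , x≢f) | inj₁ (x*∈X , x*≢f) =
  ⊥-elim (x*≢f (≡star⇒star≡ (SkewPairsAt⇒≡star X f pairs x∈X x*∈X x≢f)))

differing-element : (X Y : SubE n) → ¬ X ≐ Y → ∃[ x ] X x ≢ Y x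
differing-element X Y X≉Y
  with ¬∀⟶∃¬ _ (λ j → X (j , false) ≡ Y (j , false) × X (j , true) ≡ Y (j , true))
               (λ j → (X (j , false) ≟ᵇ Y (j , false)) ×-dec (X (j , true) ≟ᵇ Y (j , true)))
               (λ agree → X≉Y λ { (j , false) → proj₁ (agree j) ; (j , true) → proj₂ (agree j) })
... | j , disagree with X (j , false) ≟ᵇ Y (j , false)
...   | no differ = (j , false) , differ
...   | yes same = (j , true) , λ same′ → disagree (same , same′)

Orth : Family n → Set
Orth 𝒞 = ∀ C₁ C₂ → 𝒞 C₁ → 𝒞 C₂ → card (C₁ ∩ (C₂ ᶜstar)) ≢ 1

Dependent : Family n → SubE n → Set
Dependent {n} 𝒞 X = Σ (SubE n) (λ C → 𝒞 C × (C ⊆ X))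

AtMostOneSkewPair : Family n → Set
AtMostOneSkewPair 𝒞 = ∀ C → 𝒞 C → skewPairs C ≤ 1

Max : Family n → Set
Max 𝒞 = ∀ T e → IsTransversal T → e ∈ (T ᶜstar) → Dependent 𝒞 (T ∪ single e)

data Alternative (𝒞 : Family n) (W : SubE n) (f : E n) : Set where
  inside   : 𝒞 C → C ⊆ W → Alternative 𝒞 W f
  crossing : 𝒞 D → star f ∈ D → (∀ x → x ∈ D → star x ∈ W → x ≡ star f) →
             Alternative 𝒞 W f

data CircuitThrough (𝒞 : Family n) (a : E n) (W : SubE n) : Set where
  through : 𝒞 C → a ∈ C → C ⊆ (W ∪ single a) → CircuitThrough 𝒞 a W

AlternativeWhenCovering : Family n → SubE n → Fin n → Set
AlternativeWhenCovering 𝒞 W j =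
  ∀ {W′ f′} → f′ ∈ W′ → SkewPairsAt W′ (proj₁ f′) →
  Covered W′ j → (∀ {i} → Covered W i → Covered W′ i) → Alternative 𝒞 W′ f′

alternative-∪-single : (W : SubE n) (a : E n) → Alternative 𝒞 (W ∪ single a) f →
                       Alternative 𝒞 W f ⊎ CircuitThrough 𝒞 a W
alternative-∪-single W a (crossing cD f*∈D only) =
  inj₁ (crossing cD f*∈D (λ x x∈D x*∈W → only x x∈D (∈-∪ˡ W (single a) x*∈W)))
alternative-∪-single {𝒞 = 𝒞} {f = f} W a (inside {C = C} cC C⊆) = by-cases (a ∈? C)
  where
  by-cases : Dec (a ∈ C) → Alternative 𝒞 W f ⊎ CircuitThrough 𝒞 a W
  by-cases (yes a∈C) = inj₂ (through cC a∈C C⊆)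
  by-cases (no a∉C) = inj₁ (inside cC C⊆W)
    where
    C⊆W : C ⊆ W
    C⊆W x x∈C = Sum.[ id , (λ x≡a → ⊥-elim (a∉C (subst (_∈ C) x≡a x∈C))) ]
                    (∈-∪-single⁻ W a (C⊆ x x∈C))

through-or-alternative : (W : SubE n) (j : Fin n) (f : E n) → ¬ Covered W j →
                         f ∈ W → SkewPairsAt W (proj₁ f) → AlternativeWhenCovering 𝒞 W j →
                         ∀ s → Alternative 𝒞 W f ⊎ CircuitThrough 𝒞 (j , s) W
through-or-alternative W j f uncovered f∈W pairs ih s =
  alternative-∪-single W (j , s)
    (ih (∈-∪ˡ W (single (j , s)) f∈W) (SkewPairsAt-∪-single W (j , s) uncovered pairs)
        ((j , s) , ∈-∪ʳ W (single (j , s)) (∈-single⁺ (j , s)) , refl)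
        (Covered-∪ˡ W (single (j , s))))

module _ {𝒞 : Family n} (orth : Orth 𝒞) where

  crossing≢singleton : 𝒞 C → 𝒞 D → a ∈ C → star a ∈ D →
                       (∀ x → x ∈ C → star x ∈ D → x ≡ a) → ⊥
  crossing≢singleton {C = C} {D = D} {a = a} cC cD a∈C a*∈D only =
    orth C D cC cD (card-singleton (C ∩ (D ᶜstar)) a (∈-∩⁺ C (D ᶜstar) a∈C a*∈D)
                                   (λ x x∈ → let (p , q) = ∈-∩⁻ C (D ᶜstar) x∈ in only x p q))

  ¬circuits-through-both : (W : SubE n) (j : Fin n) (f : E n) → ¬ Covered W j →
                           SkewPairsAt W (proj₁ f) → star f ∉ W →
                           CircuitThrough 𝒞 (j , false) W → CircuitThrough 𝒞 (j , true) W → ⊥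
  ¬circuits-through-both W j f uncovered pairs f*∉W (through {C = C₀} c₀ a₀∈C₀ C₀⊆)
                                                    (through {C = C₁} c₁ a₁∈C₁ C₁⊆) =
    crossing≢singleton c₀ c₁ a₀∈C₀ a₁∈C₁ only
    where
    only : ∀ x → x ∈ C₀ → star x ∈ C₁ → x ≡ (j , false)
    only x x∈C₀ x*∈C₁
      with ∈-∪-single⁻ W (j , false) (C₀⊆ x x∈C₀)
         | ∈-∪-single⁻ W (j , true) (C₁⊆ (star x) x*∈C₁)
    ... | inj₂ x≡a₀ | _ = x≡a₀
    ... | inj₁ x∈W | inj₂ x*≡a₁ = ⊥-elim (∉-uncovered uncovered (cong proj₁ x*≡a₁) x∈W)
    ... | inj₁ x∈W | inj₁ x*∈W with SkewPairsAt⇒≡⊎≡star W f pairs x∈W x*∈W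
    ...   | inj₁ refl = ⊥-elim (f*∉W x*∈W)
    ...   | inj₂ refl = ⊥-elim (f*∉W x∈W)

  exchange-inside : (W : SubE n) (j : Fin n) (f : E n) → ¬ Covered W j → SkewPairsAt W (proj₁ f) →
                    (∀ s → CircuitThrough 𝒞 (j , s) W) →
                    𝒞 C → C ⊆ (remove W f ∪ fibre j) → Alternative 𝒞 W f
  exchange-inside {C = C} W j f uncovered pairs through-j cC C⊆ = by-cases (star f ∈? C)
    where
    only-f* : ∀ x → x ∈ C → star x ∈ W → x ≡ star f
    only-f* x x∈C x*∈W with ∈-remove-∪-fibre⁻ W f j (C⊆ x x∈C)
    ... | inj₁ (x∈W , x≢f) = SkewPairsAt⇒≡star W f pairs x∈W x*∈W x≢f
    ... | inj₂ x∈j = ⊥-elim (∉-uncovered uncovered x∈j x*∈W)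
    fibre-∉ : star f ∉ C → ∀ s → (j , s) ∉ C
    fibre-∉ f*∉C s a∈C with through-j (not s)
    ... | through {C = K} cK a*∈K K⊆ = crossing≢singleton cC cK a∈C a*∈K only
      where
      only : ∀ y → y ∈ C → star y ∈ K → y ≡ (j , s)
      only y y∈C y*∈K with ∈-∪-single⁻ W (j , not s) (K⊆ (star y) y*∈K)
      ... | inj₂ y*≡a* = star-injective y*≡a*
      ... | inj₁ y*∈W with ∈-remove-∪-fibre⁻ W f j (C⊆ y y∈C)
      ...   | inj₂ y∈j = ⊥-elim (∉-uncovered uncovered y∈j y*∈W)
      ...   | inj₁ (y∈W , y≢f) =
        ⊥-elim (f*∉C (subst (_∈ C) (SkewPairsAt⇒≡star W f pairs y∈W y*∈W y≢f) y∈C))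
    C⊆W : star f ∉ C → C ⊆ W
    C⊆W f*∉C x x∈C with ∈-remove-∪-fibre⁻ W f j (C⊆ x x∈C)
    ... | inj₁ (x∈W , _) = x∈W
    ... | inj₂ x∈j =
      ⊥-elim (fibre-∉ f*∉C (proj₂ x) (subst (_∈ C) (cong (_, proj₂ x) x∈j) x∈C))
    by-cases : Dec (star f ∈ C) → Alternative 𝒞 W f
    by-cases (yes f*∈C) = crossing cC f*∈C only-f*
    by-cases (no f*∉C) = inside cC (C⊆W f*∉C)

  exchange-crossing : (W : SubE n) (j : Fin n) (f : E n) → ¬ Covered W j →
                      CircuitThrough 𝒞 (j , false) W →
                      𝒞 D → (j , true) ∈ D →
                      (∀ x → x ∈ D → star x ∈ (remove W f ∪ fibre j) → x ≡ (j , true)) →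
                      Alternative 𝒞 W f
  exchange-crossing {D = D} W j f uncovered (through {C = C₀} c₀ a₀∈C₀ C₀⊆) cD a₁∈D only =
    by-cases (star f ∈? D)
    where
    only-outside-f : ∀ x → x ∈ D → star x ∈ W → star x ≢ f → x ≡ (j , true)
    only-outside-f x x∈D x*∈W x*≢f =
      only x x∈D (∈-∪ˡ (remove W f) (fibre j) (∈-remove⁺ W x*∈W x*≢f))
    only-f* : ∀ x → x ∈ D → star x ∈ W → x ≡ star f
    only-f* x x∈D x*∈W with star x ≟ᴱ f
    ... | yes x*≡f = star≡⇒≡star x*≡f
    ... | no x*≢f =
      ⊥-elim (∉-uncovered uncovered (cong proj₁ (only-outside-f x x∈D x*∈W x*≢f)) x*∈W)
    only-a₁ : star f ∉ D → ∀ x → x ∈ D → star x ∈ C₀ → x ≡ (j , true)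
    only-a₁ f*∉D x x∈D x*∈C₀ with ∈-∪-single⁻ W (j , false) (C₀⊆ (star x) x*∈C₀)
    ... | inj₂ x*≡a₀ = star-injective x*≡a₀
    ... | inj₁ x*∈W with star x ≟ᴱ f
    ...   | yes x*≡f = ⊥-elim (f*∉D (subst (_∈ D) (star≡⇒≡star x*≡f) x∈D))
    ...   | no x*≢f = only-outside-f x x∈D x*∈W x*≢f
    by-cases : Dec (star f ∈ D) → Alternative 𝒞 W f
    by-cases (yes f*∈D) = crossing cD f*∈D only-f*
    by-cases (no f*∉D) = ⊥-elim (crossing≢singleton cD c₀ a₁∈D a₀∈C₀ (only-a₁ f*∉D))

  alternative-step : (W : SubE n) (j : Fin n) (f : E n) → ¬ Covered W j →
                     f ∈ W → SkewPairsAt W (proj₁ f) → AlternativeWhenCovering 𝒞 W j →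
                     Alternative 𝒞 W f
  alternative-step W j f uncovered f∈W pairs ih =
    combine (through-or-alternative W j f uncovered f∈W pairs ih false)
            (through-or-alternative W j f uncovered f∈W pairs ih true)
    where
    a₀∈exchanged : (j , false) ∈ (remove W f ∪ fibre j)
    a₀∈exchanged = ∈-∪ʳ (remove W f) (fibre j) (∈-fibre⁺ j false)
    exchanged : star f ∈ W → Alternative 𝒞 (remove W f ∪ fibre j) (j , false)
    exchanged f*∈W =
      ih a₀∈exchanged (SkewPairsAt-remove-∪-fibre W f j pairs) ((j , false) , a₀∈exchanged , refl)
         (Covered-∪ˡ (remove W f) (fibre j) ∘ Covered-remove W f f*∈W)
    combine : Alternative 𝒞 W f ⊎ CircuitThrough 𝒞 (j , false) W →
              Alternative 𝒞 W f ⊎ CircuitThrough 𝒞 (j , true) W → Alternative 𝒞 W f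
    combine (inj₁ alt) _ = alt
    combine _ (inj₁ alt) = alt
    combine (inj₂ C₀) (inj₂ C₁) with star f ∈? W
    ... | no f*∉W = ⊥-elim (¬circuits-through-both W j f uncovered pairs f*∉W C₀ C₁)
    ... | yes f*∈W with exchanged f*∈W
    ...   | inside cC C⊆ =
      exchange-inside W j f uncovered pairs (λ { false → C₀ ; true → C₁ }) cC C⊆
    ...   | crossing cD a₁∈D only = exchange-crossing W j f uncovered C₀ cD a₁∈D only

module _ {𝒞 : Family n} (max : Max 𝒞) where

  alternative-base : (W : SubE n) (f : E n) → f ∈ W → SkewPairsAt W (proj₁ f) →
                     (∀ j → Covered W j) → Alternative 𝒞 W f
  alternative-base W f f∈W pairs cover =
    conclude (max T f (graph-isTransversal σ) (∈-graph⁺ σ (star f) σ-at-f))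
    where
    Choice : Fin n → Set
    Choice j = ∃[ s ] ((j , s) ≡ star f ⊎ ((j , s) ∈ W × j ≢ proj₁ f))
    choose : ∀ j → Choice j
    choose j with j ≟ᶠ proj₁ f | cover j
    ... | yes refl | _ = proj₂ (star f) , inj₁ refl
    ... | no j≢jf | (_ , s) , x∈W , refl = s , inj₂ (x∈W , j≢jf)
    σ : Fin n → Bool
    σ j = proj₁ (choose j)
    T : SubE n
    T = graph σ
    σ-at-f : proj₂ (star f) ≡ proj₁ (choose (proj₁ f))
    σ-at-f with choose (proj₁ f)
    ... | _ , inj₁ x≡f* = cong proj₂ (sym x≡f*)
    ... | _ , inj₂ (_ , jf≢jf) = ⊥-elim (jf≢jf refl)
    T⇒ : ∀ x → x ∈ T → x ≡ star f ⊎ (x ∈ W × proj₁ x ≢ proj₁ f)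
    T⇒ (j , s) x∈T = subst (λ t → (j , t) ≡ star f ⊎ ((j , t) ∈ W × j ≢ proj₁ f))
                           (sym (∈-graph⁻ {x = j , s} σ x∈T)) (proj₂ (choose j))
    X⊆W : ∀ {X} → X ⊆ (T ∪ single f) → (star f ∈ X → star f ∈ W) → X ⊆ W
    X⊆W X⊆ f*∈X⇒f*∈W x x∈X with ∈-∪-single⁻ T f (X⊆ x x∈X)
    ... | inj₂ refl = f∈W
    ... | inj₁ x∈T with T⇒ x x∈T
    ...   | inj₁ refl = f*∈X⇒f*∈W x∈X
    ...   | inj₂ (x∈W , _) = x∈W
    only-f* : ∀ {X} → X ⊆ (T ∪ single f) → star f ∉ W →
              ∀ x → x ∈ X → star x ∈ W → x ≡ star f
    only-f* X⊆ f*∉W x x∈X x*∈W with ∈-∪-single⁻ T f (X⊆ x x∈X)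
    ... | inj₂ refl = ⊥-elim (f*∉W x*∈W)
    ... | inj₁ x∈T with T⇒ x x∈T
    ...   | inj₁ x≡f* = x≡f*
    ...   | inj₂ (x∈W , x≢jf) = ⊥-elim (x≢jf (pairs x x∈W x*∈W))
    conclude : Dependent 𝒞 (T ∪ single f) → Alternative 𝒞 W f
    conclude (X , cX , X⊆) with star f ∈? X | star f ∈? W
    ... | no f*∉X | _ = inside cX (X⊆W X⊆ (⊥-elim ∘ f*∉X))
    ... | yes _ | yes f*∈W = inside cX (X⊆W X⊆ (λ _ → f*∈W))
    ... | yes f*∈X | no f*∉W = crossing cX f*∈X (only-f* X⊆ f*∉W)

module _ {𝒞 : Family n} (orth : Orth 𝒞) (max : Max 𝒞) where

  alternative-outside : ∀ L (W : SubE n) (f : E n) → f ∈ W → SkewPairsAt W (proj₁ f) →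
                        CoveredOutside W L → Alternative 𝒞 W f
  alternative-outside [] W f f∈W pairs cov =
    alternative-base max W f f∈W pairs (λ j → Sum.[ id , (λ ()) ] (cov j))
  alternative-outside (j ∷ L) W f f∈W pairs cov with covered? W j
  ... | yes c = alternative-outside L W f f∈W pairs (CoveredOutside-∷ c id cov)
  ... | no uncovered =
    alternative-step orth W j f uncovered f∈W pairs λ {W′} {f′} f′∈W′ pairs′ c mono →
      alternative-outside L W′ f′ f′∈W′ pairs′ (CoveredOutside-∷ c mono cov)

  alternative : (W : SubE n) (f : E n) → f ∈ W → SkewPairsAt W (proj₁ f) → Alternative 𝒞 W f
  alternative W f f∈W pairs = alternative-outside (allFin _) W f f∈W pairs (λ j → inj₂ (∈-allFin j))

  elimination : 𝒞 C₁ → 𝒞 C₂ → remove C₁ e ⊆ Z → remove C₂ e ⊆ Z → e ∈ C₂ → f ∈ C₁ → f ∉ C₂ →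
                SkewPairsAt Z (proj₁ f) → Dependent 𝒞 Z
  elimination {C₁ = C₁} {C₂ = C₂} {e = e} {Z = Z} {f = f}
              c₁ c₂ C₁∖e⊆Z C₂∖e⊆Z e∈C₂ f∈C₁ f∉C₂ pairs =
    conclude (alternative Z f (C₁∖e⊆Z f (∈-remove⁺ C₁ f∈C₁ f≢e)) pairs)
    where
    f≢e : f ≢ e
    f≢e f≡e = f∉C₂ (subst (_∈ C₂) (sym f≡e) e∈C₂)
    conclude : Alternative 𝒞 Z f → Dependent 𝒞 Z
    conclude (inside cC C⊆Z) = _ , cC , C⊆Z
    conclude (crossing {D = D} cD f*∈D only) = ⊥-elim (by-cases (star e ∈? D))
      where
      by-cases : Dec (star e ∈ D) → ⊥
      by-cases (no e*∉D) =
        crossing≢singleton orth cD c₁ f*∈D (subst (_∈ C₁) (sym (star-involutive f)) f∈C₁) only-f*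
        where
        only-f* : ∀ x → x ∈ D → star x ∈ C₁ → x ≡ star f
        only-f* x x∈D x*∈C₁ with star x ≟ᴱ e
        ... | yes x*≡e = ⊥-elim (e*∉D (subst (_∈ D) (star≡⇒≡star x*≡e) x∈D))
        ... | no x*≢e = only x x∈D (C₁∖e⊆Z (star x) (∈-remove⁺ C₁ x*∈C₁ x*≢e))
      by-cases (yes e*∈D) =
        crossing≢singleton orth cD c₂ e*∈D (subst (_∈ C₂) (sym (star-involutive e)) e∈C₂) only-e*
        where
        only-e* : ∀ x → x ∈ D → star x ∈ C₂ → x ≡ star e
        only-e* x x∈D x*∈C₂ with star x ≟ᴱ e
        ... | yes x*≡e = star≡⇒≡star x*≡e
        ... | no x*≢e = ⊥-elim (f∉C₂ (subst (_∈ C₂) x*≡f x*∈C₂))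
          where
          x*≡f : star x ≡ f
          x*≡f = ≡star⇒star≡ (only x x∈D (C₂∖e⊆Z (star x) (∈-remove⁺ C₂ x*∈C₂ x*≢e)))

  elimination-differing : 𝒞 C₁ → 𝒞 C₂ → e ∈ C₁ → e ∈ C₂ → C₁ f ≢ C₂ f →
                          SkewPairsAt (remove (C₁ ∪ C₂) e) (proj₁ f) →
                          Dependent 𝒞 (remove (C₁ ∪ C₂) e)
  elimination-differing {C₁ = C₁} {C₂ = C₂} {f = f} c₁ c₂ e∈C₁ e∈C₂ differ pairs
    with f ∈? C₁ | f ∈? C₂
  ... | yes f∈C₁ | no f∉C₂ =
    elimination c₁ c₂ (remove-mono (⊆-∪ˡ C₁ C₂)) (remove-mono (⊆-∪ʳ C₁ C₂))
                e∈C₂ f∈C₁ f∉C₂ pairs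
  ... | no f∉C₁ | yes f∈C₂ =
    elimination c₂ c₁ (remove-mono (⊆-∪ʳ C₁ C₂)) (remove-mono (⊆-∪ˡ C₁ C₂))
                e∈C₁ f∈C₂ f∉C₁ pairs
  ... | yes f∈C₁ | yes f∈C₂ = ⊥-elim (differ (trans f∈C₁ (sym f∈C₂)))
  ... | no f∉C₁ | no f∉C₂ = ⊥-elim (differ (trans (¬-not f∉C₁) (sym (¬-not f∉C₂))))

  elimination-common-pair : AtMostOneSkewPair 𝒞 → 𝒞 C₁ → 𝒞 C₂ → e ∈ C₁ → e ∈ C₂ → C₁ f ≢ C₂ f →
                            b ∈ C₁ → b ∈ C₂ → star b ∈ C₁ → star b ∈ C₂ →
                            SkewPairsAt (remove (C₁ ∪ C₂) e) (proj₁ b) →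
                            Dependent 𝒞 (remove (C₁ ∪ C₂) e)
  elimination-common-pair {C₁ = C₁} {C₂ = C₂} {e = e} {b = b}
                          skew≤1 c₁ c₂ e∈C₁ e∈C₂ differ b∈C₁ b∈C₂ b*∈C₁ b*∈C₂ pairs =
    eliminate-e (elimination-differing c₁ c₂ b∈C₁ b∈C₂ differ
                                       (SkewFree⇒SkewPairsAt ∪∖b-skewFree))
    where
    ∪∖b-skewFree : SkewFree (remove (C₁ ∪ C₂) b)
    ∪∖b-skewFree = SkewPairsAt⇒SkewFree-remove (C₁ ∪ C₂) b
      (SkewPairsAt-∪ C₁ C₂ e∈C₁ e∈C₂
        (skewPairs≤1⇒SkewPairsAt C₁ (skew≤1 C₁ c₁) b∈C₁ b*∈C₁)
        (skewPairs≤1⇒SkewPairsAt C₂ (skew≤1 C₂ c₂) b∈C₂ b*∈C₂) pairs)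
    eliminate-e : Dependent 𝒞 (remove (C₁ ∪ C₂) b) → Dependent 𝒞 (remove (C₁ ∪ C₂) e)
    eliminate-e (C₃ , c₃ , C₃⊆) = by-cases (e ∈? C₃)
      where
      C₃∖e⊆ : remove C₃ e ⊆ remove (C₁ ∪ C₂) e
      C₃∖e⊆ = remove-mono (⊆-trans C₃⊆ (remove-⊆ (C₁ ∪ C₂) b))
      b∉C₃ : b ∉ C₃
      b∉C₃ b∈C₃ = proj₂ (∈-remove⁻ (C₁ ∪ C₂) b (C₃⊆ b b∈C₃)) refl
      by-cases : Dec (e ∈ C₃) → Dependent 𝒞 (remove (C₁ ∪ C₂) e)
      by-cases (no e∉C₃) = C₃ , c₃ , ⊆-trans (⊆-remove C₃ e∉C₃) C₃∖e⊆
      by-cases (yes e∈C₃) =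
        elimination c₁ c₃ (remove-mono (⊆-∪ˡ C₁ C₂)) C₃∖e⊆ e∈C₃ b∈C₁ b∉C₃ pairs

  elimination-skew-pair : AtMostOneSkewPair 𝒞 → 𝒞 C₁ → 𝒞 C₂ → e ∈ C₁ → e ∈ C₂ → C₁ f ≢ C₂ f →
                          skewPairs (remove (C₁ ∪ C₂) e) ≤ 1 →
                          b ∈ remove (C₁ ∪ C₂) e → star b ∈ remove (C₁ ∪ C₂) e →
                          Dependent 𝒞 (remove (C₁ ∪ C₂) e)
  elimination-skew-pair {C₁ = C₁} {C₂ = C₂} {e = e} {b = b}
                        skew≤1 c₁ c₂ e∈C₁ e∈C₂ differ ≤1 b∈Z b*∈Z =
    by-cases (C₁ b ≟ᵇ C₂ b) (C₁ (star b) ≟ᵇ C₂ (star b))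
    where
    pairs : SkewPairsAt (remove (C₁ ∪ C₂) e) (proj₁ b)
    pairs = skewPairs≤1⇒SkewPairsAt (remove (C₁ ∪ C₂) e) ≤1 b∈Z b*∈Z
    in-both : ∀ {x} → x ∈ remove (C₁ ∪ C₂) e → C₁ x ≡ C₂ x → x ∈ C₁ × x ∈ C₂
    in-both {x} x∈Z = ∈-∪-agree C₁ C₂ (proj₁ (∈-remove⁻ {x = x} (C₁ ∪ C₂) e x∈Z))
    by-cases : Dec (C₁ b ≡ C₂ b) → Dec (C₁ (star b) ≡ C₂ (star b)) →
               Dependent 𝒞 (remove (C₁ ∪ C₂) e)
    by-cases (no b-differs) _ = elimination-differing c₁ c₂ e∈C₁ e∈C₂ b-differs pairs
    by-cases _ (no b*-differs) = elimination-differing c₁ c₂ e∈C₁ e∈C₂ b*-differs pairs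
    by-cases (yes b-agrees) (yes b*-agrees) =
      let (b∈C₁ , b∈C₂) = in-both b∈Z b-agrees
          (b*∈C₁ , b*∈C₂) = in-both b*∈Z b*-agrees
      in elimination-common-pair skew≤1 c₁ c₂ e∈C₁ e∈C₂ differ
                                 b∈C₁ b∈C₂ b*∈C₁ b*∈C₂ pairs

lemma3p10 : (n : ℕ) (𝒞 : Family n) →
    (∀ C → 𝒞 C → skewPairs C ≤ 1) →
    (∀ C₁ C₂ → 𝒞 C₁ → 𝒞 C₂ → card (C₁ ∩ (C₂ ᶜstar)) ≢ 1) →
    (∀ T e → IsTransversal T → e ∈ (T ᶜstar) →
      Σ (SubE n) (λ C → 𝒞 C × (C ⊆ (T ∪ single e)))) →
    ∀ C₁ C₂ e → 𝒞 C₁ → 𝒞 C₂ → ¬ (C₁ ≐ C₂) → e ∈ (C₁ ∩ C₂) →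
      skewPairs (remove (C₁ ∪ C₂) e) ≤ 1 →
      Σ (SubE n) (λ C₃ → 𝒞 C₃ × (C₃ ⊆ remove (C₁ ∪ C₂) e))
lemma3p10 n 𝒞 skew≤1 orth max C₁ C₂ e c₁ c₂ C₁≉C₂ e∈C₁∩C₂ ≤1
  with differing-element C₁ C₂ C₁≉C₂ | ∈-∩⁻ C₁ C₂ e∈C₁∩C₂
     | skewFree⊎skewPair (remove (C₁ ∪ C₂) e)
... | f , differ | e∈C₁ , e∈C₂ | inj₁ skewFree =
  elimination-differing orth max c₁ c₂ e∈C₁ e∈C₂ differ (SkewFree⇒SkewPairsAt skewFree)
... | f , differ | e∈C₁ , e∈C₂ | inj₂ (b , b∈Z , b*∈Z) =
  elimination-skew-pair orth max skew≤1 c₁ c₂ e∈C₁ e∈C₂ differ ≤1 b∈Z b*∈Z
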